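{- Let $S$ be a finite non-empty set and $p:2^S\to\mathbb{Z}\cup\{ -\infty\}$ a supermodular function with $p(\emptyset)=0$ and $p(S)$ finite; let $B=\{x\in\mathbb{R}^S:\widetilde x(S)=p(S),\ \widetilde x(Z)\ge p(Z)\ \forall Z\subseteq S\}$, and let $\beta_1$ be the smallest integer for which $B\cap\mathbb{Z}^S$ has an element all of whose components are at most $\beta_1$. Define $h_1(X)=p(X)-(\beta_1-1)|X|$ for $X\subseteq S$. Then the minimum number $r_1$ of components equal to $\beta_1$ in an element of $B\cap\mathbb{Z}^S$ all of whose components are at most $\beta_1$ satisfies $$r_1=\max\{h_1(X):X\subseteq S\}.$$
   Context: $\widetilde x(Z)=\sum_{s\in Z}x(s)$. -}

module Defs where

open import Data.Nat using (ℕ)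
open import Data.Integer using (ℤ; _+_; _-_; _*_; _≤_; +_; 0ℤ)
open import Data.Fin using (Fin)
open import Data.Fin.Subset using (Subset; ⊥; ⊤; _∩_; _∪_; ∣_∣)
open import Data.Fin.Subset.Properties using (_∈?_)
open import Data.List using (List; map; filter; foldr; length)
open import Data.List.Base using (allFin)
open import Data.Product using (Σ; ∃; _×_; _,_)
open import Relation.Binary.PropositionalEquality using (_≡_)

data ℤ∞ : Set where
  -∞  : ℤ∞
  fin : ℤ → ℤ∞

data _≤∞_ : ℤ∞ → ℤ∞ → Set where
  -∞≤     : ∀ {a} → -∞ ≤∞ a
  fin≤fin : ∀ {a b} → a ≤ b → fin a ≤∞ fin b

_+∞_ : ℤ∞ → ℤ∞ → ℤ∞
-∞    +∞ _     = -∞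
fin a +∞ -∞    = -∞
fin a +∞ fin b = fin (a + b)

Supermodular : ∀ {n} → (Subset n → ℤ∞) → Set
Supermodular {n} p = ∀ (X Y : Subset n) → (p X +∞ p Y) ≤∞ (p (X ∩ Y) +∞ p (X ∪ Y))

x̃ : ∀ {n} → (Fin n → ℤ) → Subset n → ℤ
x̃ {n} x Z = foldr _+_ 0ℤ (map x (filter (_∈? Z) (allFin n)))

InB : ∀ {n} → (Subset n → ℤ∞) → (Fin n → ℤ) → Set
InB {n} p x = (fin (x̃ x ⊤) ≡ p ⊤) × (∀ (Z : Subset n) → p Z ≤∞ fin (x̃ x Z))

AllAtMost : ∀ {n} → (Fin n → ℤ) → ℤ → Set
AllAtMost {n} x b = ∀ (i : Fin n) → x i ≤ b

IsBeta1 : ∀ {n} → (Subset n → ℤ∞) → ℤ → Set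
IsBeta1 {n} p β = (Σ (Fin n → ℤ) λ x → InB p x × AllAtMost x β)
                × (∀ (γ : ℤ) (x : Fin n → ℤ) → InB p x → AllAtMost x γ → β ≤ γ)

numEq : ∀ {n} → (Fin n → ℤ) → ℤ → ℕ
numEq {n} x b = length (filter (λ i → x i Data.Integer.≟ b) (allFin n))

h1 : ∀ {n} → (Subset n → ℤ∞) → ℤ → Subset n → ℤ∞
h1 p β X = p X +∞ fin (Data.Integer.- ((β - + 1) * + ∣ X ∣))

IsMinCount : ∀ {n} → (Subset n → ℤ∞) → ℤ → ℕ → Set
IsMinCount {n} p β r = (Σ (Fin n → ℤ) λ x → InB p x × AllAtMost x β × numEq x β ≡ r)
                     × (∀ (x : Fin n → ℤ) → InB p x → AllAtMost x β → r Data.Nat.≤ numEq x β)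

IsMax : ∀ {n} → (Subset n → ℤ∞) → ℤ → Set
IsMax {n} f m = (∃ λ (X : Subset n) → f X ≡ fin m) × (∀ (X : Subset n) → f X ≤∞ fin m)

-- Weak duality: if x ∈ B has all components ≤ β then every component in X is at most β − 1 unless it
-- equals β, so p(X) ≤ x̃(X) ≤ (β − 1)|X| + #{i : xᵢ = β}, i.e. h₁(X) never exceeds the count.
-- Strong duality: starting from any such x, as long as some s with xₛ = β and some t with xₜ ≤ β − 2
-- are not separated by a tight set (p(Z) = x̃(Z), s ∈ Z, t ∉ Z), moving one unit from s to t stays in B
-- and lowers the count.  Once every such pair is separated, tight sets being closed under ∩ and ∪ by
-- supermodularity, U = ⋃ₛ ⋂ₜ (separating sets) is tight, contains every component equal to β and only
-- components ≥ β − 1, so the bound is attained: h₁(U) equals the count.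
module Submission where

open import Defs
open import Data.Bool using (true; false; if_then_else_; _∧_; _∨_)
open import Data.Fin using (Fin; zero; suc)
open import Data.Fin.Properties using (_≟_; any?)
open import Data.Fin.Subset using (Subset; ⊥; ⊤; _∩_; _∪_; ⋂; ⋃; ∣_∣; _∈_; _∉_; inside; outside)
open import Data.Fin.Subset.Properties using (_∈?_; x∈p∩q⁺; x∈p∩q⁻; x∈p∪q⁺; x∈p∪q⁻; ∉⊥; ∈⊤; anySubset?)
open import Data.Integer as ℤ using (ℤ; +_; 0ℤ; 1ℤ; _+_; _-_; _*_; -_; _≤_; _<_)
import Data.Integer.Properties as ℤP
open import Data.Integer.Tactic.RingSolver using (solve-∀)
open import Algebra.Properties.CommutativeMonoid.Sum ℤP.+-0-commutativeMonoid
  using (sum; sum-syntax; sum-cong-≗; ∑-distrib-+; sum-replicate-zero)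
open import Data.List using (List; []; _∷_; map; filter; foldr; length; tabulate; allFin)
open import Data.List.Relation.Unary.All using (All; []; _∷_)
import Data.List.Relation.Unary.All.Properties as All
open import Data.List.Relation.Unary.Any using (Any; here; there)
import Data.List.Relation.Unary.Any.Properties as Any
open import Data.Nat as ℕ using (ℕ; zero; suc)
import Data.Nat.Properties as ℕP
open import Data.Product using (Σ; ∃; ∃₂; _×_; _,_; proj₁; proj₂)
open import Data.Sum using (inj₁; inj₂; [_,_])
open import Data.Vec using ([]; _∷_)
open import Function using (_∘_; id; const; flip)
open import Relation.Binary.PropositionalEquality hiding ([_])
open import Relation.Nullary using (Dec; yes; no; does; ¬_; contradiction)
open import Relation.Nullary.Decidable using (dec-true; dec-false; _×-dec_; ¬?)
open import Relation.Unary using (Pred; Decidable)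

+-squeeze : ∀ {a b c d} → c ≤ a → d ≤ b → a + b ≤ c + d → c ≡ a × d ≡ b
+-squeeze c≤a d≤b a+b≤c+d =
    ℤP.≤-antisym c≤a (ℤP.≮⇒≥ λ c<a → ℤP.<⇒≱ (ℤP.+-mono-<-≤ c<a d≤b) a+b≤c+d)
  , ℤP.≤-antisym d≤b (ℤP.≮⇒≥ λ d<b → ℤP.<⇒≱ (ℤP.+-mono-≤-< c≤a d<b) a+b≤c+d)

≤∞-fin-trans : ∀ {u a b} → u ≤∞ fin a → a ≤ b → u ≤∞ fin b
≤∞-fin-trans -∞≤          a≤b = -∞≤
≤∞-fin-trans (fin≤fin c≤a) a≤b = fin≤fin (ℤP.≤-trans c≤a a≤b)

≤∞∧≢⇒≤-1 : ∀ {u a} → u ≤∞ fin a → u ≢ fin a → u ≤∞ fin (a - 1ℤ)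
≤∞∧≢⇒≤-1 -∞≤          _   = -∞≤
≤∞∧≢⇒≤-1 {a = a} (fin≤fin c≤a) c≢a =
  fin≤fin (subst (_ ≤_) (ℤP.+-comm (- 1ℤ) a) (ℤP.i<j⇒i≤pred[j] (ℤP.≤∧≢⇒< c≤a (c≢a ∘ cong fin))))

+∞-squeeze : ∀ {u v a b} → u ≤∞ fin a → v ≤∞ fin b → fin (a + b) ≤∞ (u +∞ v) → u ≡ fin a × v ≡ fin b
+∞-squeeze (fin≤fin c≤a) (fin≤fin d≤b) (fin≤fin a+b≤c+d) with +-squeeze c≤a d≤b a+b≤c+d
... | refl , refl = refl , refl

i+j-i≡j : ∀ i j → i + j - i ≡ j
i+j-i≡j = solve-∀

+∞-neg-≤ : ∀ {u} c m → u ≤∞ fin (c + m) → (u +∞ fin (- c)) ≤∞ fin m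
+∞-neg-≤ c m -∞≤                 = -∞≤
+∞-neg-≤ c m (fin≤fin d≤c+m) =
  fin≤fin (subst (_ ≤_) (i+j-i≡j c m) (ℤP.+-monoˡ-≤ (- c) d≤c+m))

+∞-neg-≡ : ∀ {u} c m → u ≡ fin (c + m) → (u +∞ fin (- c)) ≡ fin m
+∞-neg-≡ c m refl = cong fin (i+j-i≡j c m)

_≟fin_ : (u : ℤ∞) (a : ℤ) → Dec (u ≡ fin a)
-∞    ≟fin a = no λ ()
fin c ≟fin a with c ℤ.≟ a
... | yes refl = yes refl
... | no  c≢a  = no λ { refl → c≢a refl }

when : ∀ {a} {A : Set a} → Dec A → ℤ → ℤ
when a? v = if does a? then v else 0ℤ

⟦_⟧ : ∀ {a} {A : Set a} → Dec A → ℤ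
⟦ a? ⟧ = when a? 1ℤ

0≤⟦_⟧ : ∀ {a} {A : Set a} (a? : Dec A) → 0ℤ ≤ ⟦ a? ⟧
0≤⟦ a? ⟧ with does a?
... | true  = ℤ.+≤+ ℕ.z≤n
... | false = ℤP.≤-refl

⟦⟧-yes : ∀ {a} {A : Set a} (a? : Dec A) → A → ⟦ a? ⟧ ≡ 1ℤ
⟦⟧-yes a? a = cong (λ b → if b then 1ℤ else 0ℤ) (dec-true a? a)

⟦⟧-no : ∀ {a} {A : Set a} (a? : Dec A) → ¬ A → ⟦ a? ⟧ ≡ 0ℤ
⟦⟧-no a? ¬a = cong (λ b → if b then 1ℤ else 0ℤ) (dec-false a? ¬a)

sum-mono-≤ : ∀ {n} {f g : Fin n → ℤ} → (∀ i → f i ≤ g i) → sum f ≤ sum g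
sum-mono-≤ {zero}  f≤g = ℤP.≤-refl
sum-mono-≤ {suc n} f≤g = ℤP.+-mono-≤ (f≤g zero) (sum-mono-≤ (f≤g ∘ suc))

∑-distrib-- : ∀ {n} (f g : Fin n → ℤ) → ∑[ i < n ] (f i - g i) ≡ sum f - sum g
∑-distrib-- {zero}  f g = refl
∑-distrib-- {suc n} f g =
  trans (cong (_+_ (f zero - g zero)) (∑-distrib-- (f ∘ suc) (g ∘ suc)))
        (interchange (f zero) (g zero) (sum (f ∘ suc)) (sum (g ∘ suc)))
  where
  interchange : ∀ a b c d → (a - b) + (c - d) ≡ (a + c) - (b + d)
  interchange = solve-∀

sum-when-≟ : ∀ {n} (f : Fin n → ℤ) s → ∑[ i < n ] when (i ≟ s) (f i) ≡ f s
sum-when-≟ {suc n} f zero    = trans (cong (_+_ (f zero)) (sum-replicate-zero n)) (ℤP.+-identityʳ (f zero))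
sum-when-≟ {suc n} f (suc s) = trans (ℤP.+-identityˡ _) (sum-when-≟ (f ∘ suc) s)

foldr-map-tabulate : ∀ {A : Set} {n} (f : A → ℤ) (g : Fin n → A) →
                     foldr _+_ 0ℤ (map f (tabulate g)) ≡ sum (f ∘ g)
foldr-map-tabulate {n = zero}  f g = refl
foldr-map-tabulate {n = suc n} f g = cong (_+_ (f (g zero))) (foldr-map-tabulate f (g ∘ suc))

foldr-map-filter : ∀ {a p} {A : Set a} {P : Pred A p} (P? : Decidable P) (f : A → ℤ) (xs : List A) →
                   foldr _+_ 0ℤ (map f (filter P? xs)) ≡ foldr _+_ 0ℤ (map (λ a → when (P? a) (f a)) xs)
foldr-map-filter P? f []       = refl
foldr-map-filter P? f (a ∷ xs) with P? a
... | yes _ = cong (_+_ (f a)) (foldr-map-filter P? f xs)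
... | no  _ = trans (foldr-map-filter P? f xs) (sym (ℤP.+-identityˡ _))

length-filter : ∀ {a p} {A : Set a} {P : Pred A p} (P? : Decidable P) (xs : List A) →
                + length (filter P? xs) ≡ foldr _+_ 0ℤ (map (λ a → ⟦ P? a ⟧) xs)
length-filter P? []       = refl
length-filter P? (a ∷ xs) with P? a
... | yes _ = trans (ℤP.pos-+ 1 (length (filter P? xs))) (cong (_+_ 1ℤ) (length-filter P? xs))
... | no  _ = trans (length-filter P? xs) (sym (ℤP.+-identityˡ _))

restrict : ∀ {n} → (Fin n → ℤ) → Subset n → Fin n → ℤ
restrict x Z i = when (i ∈? Z) (x i)

x̃≡sum : ∀ {n} (x : Fin n → ℤ) (Z : Subset n) → x̃ x Z ≡ sum (restrict x Z)
x̃≡sum {n} x Z = trans (foldr-map-filter (_∈? Z) x (allFin n)) (foldr-map-tabulate _ (id {A = Fin n}))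

numEq≡sum : ∀ {n} (x : Fin n → ℤ) (b : ℤ) → + numEq x b ≡ ∑[ i < n ] ⟦ x i ℤ.≟ b ⟧
numEq≡sum {n} x b = trans (length-filter (λ i → x i ℤ.≟ b) (allFin n)) (foldr-map-tabulate _ (id {A = Fin n}))

*-card≡sum : ∀ {n} (c : ℤ) (X : Subset n) → c * + ∣ X ∣ ≡ ∑[ i < n ] when (i ∈? X) c
*-card≡sum c []            = ℤP.*-zeroʳ c
*-card≡sum c (inside ∷ X)  = trans (ℤP.*-suc c (+ ∣ X ∣)) (cong (_+_ c) (*-card≡sum c X))
*-card≡sum c (outside ∷ X) = trans (*-card≡sum c X) (sym (ℤP.+-identityˡ _))

does-∈?-∩ : ∀ {n} (i : Fin n) (X Y : Subset n) → does (i ∈? X ∩ Y) ≡ does (i ∈? X) ∧ does (i ∈? Y)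
does-∈?-∩ i X Y with i ∈? X | i ∈? Y
... | yes i∈X | yes i∈Y = dec-true  (i ∈? X ∩ Y) (x∈p∩q⁺ (i∈X , i∈Y))
... | yes _   | no  i∉Y = dec-false (i ∈? X ∩ Y) (i∉Y ∘ proj₂ ∘ x∈p∩q⁻ X Y)
... | no  i∉X | _       = dec-false (i ∈? X ∩ Y) (i∉X ∘ proj₁ ∘ x∈p∩q⁻ X Y)

does-∈?-∪ : ∀ {n} (i : Fin n) (X Y : Subset n) → does (i ∈? X ∪ Y) ≡ does (i ∈? X) ∨ does (i ∈? Y)
does-∈?-∪ i X Y with i ∈? X | i ∈? Y
... | yes i∈X | _       = dec-true  (i ∈? X ∪ Y) (x∈p∪q⁺ (inj₁ i∈X))
... | no  _   | yes i∈Y = dec-true  (i ∈? X ∪ Y) (x∈p∪q⁺ (inj₂ i∈Y))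
... | no  i∉X | no  i∉Y = dec-false (i ∈? X ∪ Y) ([ i∉X , i∉Y ] ∘ x∈p∪q⁻ X Y)

x∈⋂⁺ : ∀ {n} {i : Fin n} {Zs : List (Subset n)} → All (i ∈_) Zs → i ∈ ⋂ Zs
x∈⋂⁺ []           = ∈⊤
x∈⋂⁺ (i∈Z ∷ i∈Zs) = x∈p∩q⁺ (i∈Z , x∈⋂⁺ i∈Zs)

x∉⋂⁺ : ∀ {n} {i : Fin n} {Zs : List (Subset n)} → Any (i ∉_) Zs → i ∉ ⋂ Zs
x∉⋂⁺ {Zs = Z ∷ _} (here i∉Z)    = i∉Z ∘ proj₁ ∘ x∈p∩q⁻ Z _
x∉⋂⁺ {Zs = Z ∷ _} (there i∉Zs)  = x∉⋂⁺ i∉Zs ∘ proj₂ ∘ x∈p∩q⁻ Z _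

x∈⋃⁺ : ∀ {n} {i : Fin n} {Zs : List (Subset n)} → Any (i ∈_) Zs → i ∈ ⋃ Zs
x∈⋃⁺ (here i∈Z)    = x∈p∪q⁺ (inj₁ i∈Z)
x∈⋃⁺ (there i∈Zs)  = x∈p∪q⁺ (inj₂ (x∈⋃⁺ i∈Zs))

x∉⋃⁺ : ∀ {n} {i : Fin n} {Zs : List (Subset n)} → All (i ∉_) Zs → i ∉ ⋃ Zs
x∉⋃⁺ []                    = ∉⊥
x∉⋃⁺ {Zs = Z ∷ _} (i∉Z ∷ i∉Zs) = [ i∉Z , x∉⋃⁺ i∉Zs ] ∘ x∈p∪q⁻ Z _

if-∧-∨ : ∀ a b (v : ℤ) → (if a then v else 0ℤ) + (if b then v else 0ℤ) ≡
                         (if a ∧ b then v else 0ℤ) + (if a ∨ b then v else 0ℤ)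
if-∧-∨ true  true  v = refl
if-∧-∨ true  false v = ℤP.+-comm v 0ℤ
if-∧-∨ false b     v = refl

x̃-modular : ∀ {n} (x : Fin n → ℤ) (X Y : Subset n) → x̃ x X + x̃ x Y ≡ x̃ x (X ∩ Y) + x̃ x (X ∪ Y)
x̃-modular {n} x X Y = begin
  x̃ x X + x̃ x Y                                      ≡⟨ cong₂ _+_ (x̃≡sum x X) (x̃≡sum x Y) ⟩
  sum (restrict x X) + sum (restrict x Y)              ≡⟨ ∑-distrib-+ (restrict x X) (restrict x Y) ⟨
  ∑[ i < n ] (restrict x X i + restrict x Y i)         ≡⟨ sum-cong-≗ pointwise ⟩
  ∑[ i < n ] (restrict x X∩Y i + restrict x X∪Y i)     ≡⟨ ∑-distrib-+ (restrict x X∩Y) (restrict x X∪Y) ⟩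
  sum (restrict x X∩Y) + sum (restrict x X∪Y)          ≡⟨ cong₂ _+_ (x̃≡sum x X∩Y) (x̃≡sum x X∪Y) ⟨
  x̃ x X∩Y + x̃ x X∪Y                                  ∎
  where
  open ≡-Reasoning
  X∩Y X∪Y : Subset n
  X∩Y = X ∩ Y
  X∪Y = X ∪ Y
  pointwise : ∀ i → restrict x X i + restrict x Y i ≡ restrict x X∩Y i + restrict x X∪Y i
  pointwise i = trans (if-∧-∨ (does (i ∈? X)) (does (i ∈? Y)) (x i))
    (sym (cong₂ (λ a b → (if a then x i else 0ℤ) + (if b then x i else 0ℤ))
                (does-∈?-∩ i X Y) (does-∈?-∪ i X Y)))

x̃-⊥ : ∀ {n} (x : Fin n → ℤ) → x̃ x ⊥ ≡ 0ℤ
x̃-⊥ {n} x = begin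
  x̃ x ⊥                ≡⟨ x̃≡sum x ⊥ ⟩
  sum (restrict x ⊥)   ≡⟨ sum-cong-≗ (λ i → cong (λ b → if b then x i else 0ℤ) (dec-false (i ∈? ⊥) ∉⊥)) ⟩
  ∑[ i < n ] 0ℤ        ≡⟨ sum-replicate-zero n ⟩
  0ℤ                   ∎
  where open ≡-Reasoning

Tight : ∀ {n} → (Subset n → ℤ∞) → (Fin n → ℤ) → Subset n → Set
Tight p x Z = p Z ≡ fin (x̃ x Z)

tight-⊤ : ∀ {n} {p : Subset n → ℤ∞} {x : Fin n → ℤ} → InB p x → Tight p x ⊤
tight-⊤ = sym ∘ proj₁

tight-⊥ : ∀ {n} {p : Subset n → ℤ∞} (x : Fin n → ℤ) → p ⊥ ≡ fin 0ℤ → Tight p x ⊥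
tight-⊥ x p⊥≡0 = trans p⊥≡0 (cong fin (sym (x̃-⊥ x)))

module _ {n} {p : Subset n → ℤ∞} (sup : Supermodular p) {x : Fin n → ℤ} (x∈B : InB p x) where

  tight-∩∪ : ∀ {X Y} → Tight p x X → Tight p x Y → Tight p x (X ∩ Y) × Tight p x (X ∪ Y)
  tight-∩∪ {X} {Y} tX tY = +∞-squeeze (proj₂ x∈B (X ∩ Y)) (proj₂ x∈B (X ∪ Y))
    (subst (_≤∞ (p (X ∩ Y) +∞ p (X ∪ Y))) (trans (cong₂ _+∞_ tX tY) (cong fin (x̃-modular x X Y))) (sup X Y))

  tight-⋂ : ∀ {Zs} → All (Tight p x) Zs → Tight p x (⋂ Zs)
  tight-⋂ []         = tight-⊤ x∈B
  tight-⋂ (tZ ∷ tZs) = proj₁ (tight-∩∪ tZ (tight-⋂ tZs))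

  tight-⋃ : p ⊥ ≡ fin 0ℤ → ∀ {Zs} → All (Tight p x) Zs → Tight p x (⋃ Zs)
  tight-⋃ p⊥≡0 []         = tight-⊥ {p = p} x p⊥≡0
  tight-⋃ p⊥≡0 (tZ ∷ tZs) = proj₂ (tight-∩∪ tZ (tight-⋃ p⊥≡0 tZs))

module _ (β : ℤ) where

  private
    i-1+1≡i : ∀ i → i - 1ℤ + 1ℤ ≡ i
    i-1+1≡i = solve-∀

    -1+i≡i-1+0 : ∀ i → - 1ℤ + i ≡ i - 1ℤ + 0ℤ
    -1+i≡i-1+0 = solve-∀

    i≡i+1-1+0 : ∀ i → i ≡ i + 1ℤ - 1ℤ + 0ℤ
    i≡i+1-1+0 = solve-∀

  when-≤-split : ∀ {a} {A : Set a} (a? : Dec A) {y} → y ≤ β → when a? y ≤ when a? (β - 1ℤ) + ⟦ y ℤ.≟ β ⟧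
  when-≤-split a? {y} y≤β with does a? | y ℤ.≟ β
  ... | true  | yes refl = ℤP.≤-reflexive (sym (i-1+1≡i β))
  ... | true  | no  y≢β  = subst (y ≤_) (-1+i≡i-1+0 β) (ℤP.i<j⇒i≤pred[j] (ℤP.≤∧≢⇒< y≤β y≢β))
  ... | false | y≟β      = subst (0ℤ ≤_) (sym (ℤP.+-identityˡ ⟦ y≟β ⟧)) 0≤⟦ y≟β ⟧

  when-≡-split : ∀ {a} {A : Set a} (a? : Dec A) {y} → y ≤ β → (y ≡ β → A) → (A → ¬ y + 1ℤ < β) →
                 when a? y ≡ when a? (β - 1ℤ) + ⟦ y ℤ.≟ β ⟧
  when-≡-split a? {y} y≤β y≡β⇒a a⇒y+1≮β with a? | y ℤ.≟ β
  ... | yes _ | yes refl = sym (i-1+1≡i β)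
  ... | yes a | no  y≢β  = trans (i≡i+1-1+0 y) (cong (λ z → z - 1ℤ + 0ℤ) y+1≡β)
    where
    y+1≡β : y + 1ℤ ≡ β
    y+1≡β = ℤP.≤-antisym (subst (_≤ β) (ℤP.+-comm 1ℤ y) (ℤP.i<j⇒suc[i]≤j (ℤP.≤∧≢⇒< y≤β y≢β)))
                         (ℤP.≮⇒≥ (a⇒y+1≮β a))
  ... | no ¬a | yes y≡β  = contradiction (y≡β⇒a y≡β) ¬a
  ... | no _  | no _     = refl

  module _ {n} (x : Fin n → ℤ) (x≤β : AllAtMost x β) (X : Subset n) where

    private
      sum-split : ∑[ i < n ] (when (i ∈? X) (β - 1ℤ) + ⟦ x i ℤ.≟ β ⟧) ≡ (β - 1ℤ) * + ∣ X ∣ + + numEq x β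
      sum-split = trans (∑-distrib-+ (λ i → when (i ∈? X) (β - 1ℤ)) (λ i → ⟦ x i ℤ.≟ β ⟧))
                        (sym (cong₂ _+_ (*-card≡sum (β - 1ℤ) X) (numEq≡sum x β)))

    x̃≤[β-1]∣X∣+numEq : x̃ x X ≤ (β - 1ℤ) * + ∣ X ∣ + + numEq x β
    x̃≤[β-1]∣X∣+numEq = subst₂ _≤_ (sym (x̃≡sum x X)) sum-split
      (sum-mono-≤ (λ i → when-≤-split (i ∈? X) (x≤β i)))

    x̃≡[β-1]∣X∣+numEq : (∀ i → x i ≡ β → i ∈ X) → (∀ i → i ∈ X → ¬ x i + 1ℤ < β) →
                       x̃ x X ≡ (β - 1ℤ) * + ∣ X ∣ + + numEq x β
    x̃≡[β-1]∣X∣+numEq top∈X X∌low = trans (x̃≡sum x X) (trans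
      (sum-cong-≗ (λ i → when-≡-split (i ∈? X) (x≤β i) (top∈X i) (X∌low i))) sum-split)

    h1≤numEq : ∀ {p : Subset n → ℤ∞} → InB p x → h1 p β X ≤∞ fin (+ numEq x β)
    h1≤numEq x∈B = +∞-neg-≤ ((β - 1ℤ) * + ∣ X ∣) (+ numEq x β)
      (≤∞-fin-trans (proj₂ x∈B X) x̃≤[β-1]∣X∣+numEq)

    h1≡numEq : ∀ {p : Subset n → ℤ∞} → Tight p x X → (∀ i → x i ≡ β → i ∈ X) →
               (∀ i → i ∈ X → ¬ x i + 1ℤ < β) → h1 p β X ≡ fin (+ numEq x β)
    h1≡numEq tight top∈X X∌low = +∞-neg-≡ ((β - 1ℤ) * + ∣ X ∣) (+ numEq x β)
      (trans tight (cong fin (x̃≡[β-1]∣X∣+numEq top∈X X∌low)))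

when-transfer : ∀ {a b c} {A : Set a} {B : Set b} {C : Set c} (a? : Dec A) (b? : Dec B) (c? : Dec C) y →
                when a? (y + (⟦ b? ⟧ - ⟦ c? ⟧)) ≡ when a? y + (when b? ⟦ a? ⟧ - when c? ⟦ a? ⟧)
when-transfer a? b? c? y with does a?
... | true  = refl
... | false with does b? | does c?
...   | true  | true  = refl
...   | true  | false = refl
...   | false | true  = refl
...   | false | false = refl

transfer : ∀ {n} → (Fin n → ℤ) → Fin n → Fin n → Fin n → ℤ
transfer x s t i = x i + (⟦ i ≟ t ⟧ - ⟦ i ≟ s ⟧)

x̃-transfer : ∀ {n} (x : Fin n → ℤ) s t (Z : Subset n) → x̃ (transfer x s t) Z ≡ x̃ x Z + (⟦ t ∈? Z ⟧ - ⟦ s ∈? Z ⟧)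
x̃-transfer {n} x s t Z = begin
  x̃ (transfer x s t) Z
    ≡⟨ x̃≡sum (transfer x s t) Z ⟩
  sum (restrict (transfer x s t) Z)
    ≡⟨ sum-cong-≗ (λ i → when-transfer (i ∈? Z) (i ≟ t) (i ≟ s) (x i)) ⟩
  ∑[ i < n ] (restrict x Z i + (δ t i - δ s i))
    ≡⟨ ∑-distrib-+ (restrict x Z) (λ i → δ t i - δ s i) ⟩
  sum (restrict x Z) + ∑[ i < n ] (δ t i - δ s i)
    ≡⟨ cong₂ _+_ (sym (x̃≡sum x Z)) (∑-distrib-- (δ t) (δ s)) ⟩
  x̃ x Z + (sum (δ t) - sum (δ s))
    ≡⟨ cong (λ d → x̃ x Z + d) (cong₂ _-_ (sum-when-≟ (λ i → ⟦ i ∈? Z ⟧) t) (sum-when-≟ (λ i → ⟦ i ∈? Z ⟧) s)) ⟩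
  x̃ x Z + (⟦ t ∈? Z ⟧ - ⟦ s ∈? Z ⟧) ∎
  where
  open ≡-Reasoning
  δ : Fin n → Fin n → ℤ
  δ u i = when (i ≟ u) ⟦ i ∈? Z ⟧

Separates : ∀ {n} → (Subset n → ℤ∞) → (Fin n → ℤ) → Fin n → Fin n → Subset n → Set
Separates p x s t Z = Tight p x Z × s ∈ Z × t ∉ Z

separates? : ∀ {n} (p : Subset n → ℤ∞) x (s t : Fin n) → Decidable (Separates p x s t)
separates? p x s t Z = (p Z ≟fin x̃ x Z) ×-dec (s ∈? Z) ×-dec ¬? (t ∈? Z)

module _ {n} {p : Subset n → ℤ∞} {β : ℤ} {x : Fin n → ℤ} (x∈B : InB p x) (x≤β : AllAtMost x β)
         {s t : Fin n} (xs≡β : x s ≡ β) (xt+1<β : x t + 1ℤ < β) (unseparated : ¬ ∃ (Separates p x s t)) where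

  private
    xt<β : x t < β
    xt<β = ℤP.≤-<-trans (ℤP.i≤i+j (x t) 1ℤ) xt+1<β

    s≢t : s ≢ t
    s≢t refl = ℤP.<⇒≢ xt<β xs≡β

    i-1<i : ∀ i → i - 1ℤ < i
    i-1<i i = ℤP.i≤pred[j]⇒i<j (ℤP.≤-reflexive (ℤP.+-comm i (- 1ℤ)))

  transfer-InB : InB p (transfer x s t)
  transfer-InB = trans (cong fin total) (proj₁ x∈B) , λ Z → subst (λ v → p Z ≤∞ fin v) (sym (x̃-transfer x s t Z)) (bound Z)
    where
    total : x̃ (transfer x s t) ⊤ ≡ x̃ x ⊤
    total = trans (x̃-transfer x s t ⊤) (trans
      (cong (_+_ (x̃ x ⊤)) (cong₂ _-_ (⟦⟧-yes (t ∈? ⊤) ∈⊤) (⟦⟧-yes (s ∈? ⊤) ∈⊤))) (ℤP.+-identityʳ _))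

    bound : ∀ Z → p Z ≤∞ fin (x̃ x Z + (⟦ t ∈? Z ⟧ - ⟦ s ∈? Z ⟧))
    bound Z with t ∈? Z | s ∈? Z
    ... | yes _   | yes _   = ≤∞-fin-trans (proj₂ x∈B Z) (ℤP.≤-reflexive (sym (ℤP.+-identityʳ _)))
    ... | yes _   | no  _   = ≤∞-fin-trans (proj₂ x∈B Z) (ℤP.i≤i+j _ 1ℤ)
    ... | no  t∉Z | yes s∈Z = ≤∞∧≢⇒≤-1 (proj₂ x∈B Z) (λ tight → unseparated (Z , tight , s∈Z , t∉Z))
    ... | no  _   | no  _   = ≤∞-fin-trans (proj₂ x∈B Z) (ℤP.≤-reflexive (sym (ℤP.+-identityʳ _)))

  transfer-≤ : AllAtMost (transfer x s t) β
  transfer-≤ i with i ≟ t | i ≟ s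
  ... | yes refl | no _ = ℤP.<⇒≤ xt+1<β
  ... | no _     | yes _ = ℤP.<⇒≤ (ℤP.<-≤-trans (i-1<i (x i)) (x≤β i))
  ... | yes _    | yes _ = subst (_≤ β) (sym (ℤP.+-identityʳ (x i))) (x≤β i)
  ... | no _     | no _  = subst (_≤ β) (sym (ℤP.+-identityʳ (x i))) (x≤β i)

  numEq-transfer : numEq x β ≡ suc (numEq (transfer x s t) β)
  numEq-transfer = ℤP.+-injective (begin
    + numEq x β                                     ≡⟨ numEq≡sum x β ⟩
    ∑[ i < n ] ⟦ x i ℤ.≟ β ⟧                        ≡⟨ sum-cong-≗ lost ⟨
    ∑[ i < n ] (⟦ x' i ℤ.≟ β ⟧ + ⟦ i ≟ s ⟧)          ≡⟨ ∑-distrib-+ (λ i → ⟦ x' i ℤ.≟ β ⟧) (λ i → ⟦ i ≟ s ⟧) ⟩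
    sum (λ i → ⟦ x' i ℤ.≟ β ⟧) + sum (λ i → ⟦ i ≟ s ⟧)
      ≡⟨ cong₂ _+_ (sym (numEq≡sum x' β)) (sum-when-≟ (λ _ → 1ℤ) s) ⟩
    + numEq x' β + 1ℤ                               ≡⟨ cong (+_) (ℕP.+-comm (numEq x' β) 1) ⟩
    + suc (numEq x' β)                              ∎)
    where
    open ≡-Reasoning
    x' : Fin n → ℤ
    x' = transfer x s t
    lost : ∀ i → ⟦ x' i ℤ.≟ β ⟧ + ⟦ i ≟ s ⟧ ≡ ⟦ x i ℤ.≟ β ⟧
    lost i with i ≟ t | i ≟ s
    ... | yes refl | yes refl = contradiction refl s≢t
    ... | yes refl | no _     = trans (ℤP.+-identityʳ _)
      (trans (⟦⟧-no (_ ℤ.≟ β) (ℤP.<⇒≢ xt+1<β)) (sym (⟦⟧-no (_ ℤ.≟ β) (ℤP.<⇒≢ xt<β))))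
    ... | no _     | yes refl = trans (cong (λ v → v + 1ℤ) (⟦⟧-no (_ ℤ.≟ β) (ℤP.<⇒≢ (subst (x s - 1ℤ <_) xs≡β (i-1<i (x s))))))
      (sym (⟦⟧-yes (_ ℤ.≟ β) xs≡β))
    ... | no _     | no _     = trans (ℤP.+-identityʳ _) (cong (λ v → ⟦ v ℤ.≟ β ⟧) (ℤP.+-identityʳ (x i)))

module _ {n} {p : Subset n → ℤ∞} (sup : Supermodular p) (p⊥≡0 : p ⊥ ≡ fin 0ℤ) (β : ℤ) where

  Exchangeable : (Fin n → ℤ) → Set
  Exchangeable x = ∃₂ λ s t → x s ≡ β × x t + 1ℤ < β × ¬ ∃ (Separates p x s t)

  exchangeable? : ∀ x → Dec (Exchangeable x)
  exchangeable? x = any? λ s → any? λ t →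
    (x s ℤ.≟ β) ×-dec (x t + 1ℤ ℤ.<? β) ×-dec ¬? (anySubset? (separates? p x s t))

  module _ {x : Fin n → ℤ} (x∈B : InB p x) (x≤β : AllAtMost x β) (¬exch : ¬ Exchangeable x) where

    record Guard (s t : Fin n) : Set where
      field
        set     : Subset n
        tight   : Tight p x set
        keeps-s : x s ≡ β → s ∈ set
        drops-t : x t + 1ℤ < β → t ∉ set
    open Guard

    guard : ∀ s t → Guard s t
    guard s t with x s ℤ.≟ β
    ... | no xs≢β = record { set = ⊥ ; tight = tight-⊥ {p = p} x p⊥≡0
                           ; keeps-s = flip contradiction xs≢β ; drops-t = const ∉⊥ }
    ... | yes xs≡β with anySubset? (separates? p x s t)
    ...   | yes (Z , tight , s∈Z , t∉Z) = record { set = Z ; tight = tight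
                                                 ; keeps-s = const s∈Z ; drops-t = const t∉Z }
    ...   | no unsep = record { set = ⊤ ; tight = tight-⊤ x∈B ; keeps-s = const ∈⊤
                              ; drops-t = λ xt+1<β → contradiction (s , t , xs≡β , xt+1<β , unsep) ¬exch }

    W : Fin n → Subset n
    W s = ⋂ (tabulate λ t → set (guard s t))

    U : Subset n
    U = ⋃ (tabulate W)

    U-tight : Tight p x U
    U-tight = tight-⋃ sup x∈B p⊥≡0 (All.tabulate⁺ λ s → tight-⋂ sup x∈B (All.tabulate⁺ λ t → tight (guard s t)))

    top⊆U : ∀ i → x i ≡ β → i ∈ U
    top⊆U i xi≡β = x∈⋃⁺ (Any.tabulate⁺ i (x∈⋂⁺ (All.tabulate⁺ λ t → keeps-s (guard i t) xi≡β)))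

    U∌low : ∀ i → i ∈ U → ¬ x i + 1ℤ < β
    U∌low i i∈U low = x∉⋃⁺ (All.tabulate⁺ λ s → x∉⋂⁺ (Any.tabulate⁺ i (drops-t (guard s i) low))) i∈U

    h1[U]≡numEq : h1 p β U ≡ fin (+ numEq x β)
    h1[U]≡numEq = h1≡numEq β x x≤β U {p = p} U-tight top⊆U U∌low

  CertifiedPoint : Set
  CertifiedPoint = Σ (Fin n → ℤ) λ y → InB p y × AllAtMost y β × ∃ λ U → h1 p β U ≡ fin (+ numEq y β)

  -- k bounds the remaining descent: each transfer lowers numEq x β by one.
  certified : ∀ k {x} → InB p x → AllAtMost x β → numEq x β ≡ k → CertifiedPoint
  certified k {x} x∈B x≤β _ with exchangeable? x
  certified k {x} x∈B x≤β _ | no ¬exch =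
    x , x∈B , x≤β , U x∈B x≤β ¬exch , h1[U]≡numEq x∈B x≤β ¬exch
  certified zero x∈B x≤β #x≡0 | yes (_ , _ , xs≡β , xt+1<β , unsep)
    with () ← trans (sym #x≡0) (numEq-transfer x∈B x≤β xs≡β xt+1<β unsep)
  certified (suc k) x∈B x≤β #x≡k | yes (_ , _ , xs≡β , xt+1<β , unsep) =
    certified k (transfer-InB x∈B x≤β xs≡β xt+1<β unsep) (transfer-≤ x∈B x≤β xs≡β xt+1<β unsep)
      (ℕP.suc-injective (trans (sym (numEq-transfer x∈B x≤β xs≡β xt+1<β unsep)) #x≡k))

theorem4p3 : ∀ (n : ℕ) (p : Subset (suc n) → ℤ∞) →
    Supermodular p → p ⊥ ≡ fin 0ℤ → (Σ ℤ λ c → p ⊤ ≡ fin c) →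
    ∀ (β₁ : ℤ) → IsBeta1 p β₁ →
    Σ ℕ λ r₁ → IsMinCount p β₁ r₁ × IsMax (h1 p β₁) (+ r₁)
theorem4p3 n p sup p⊥≡0 _ β₁ ((x₀ , x₀∈B , x₀≤β₁) , _)
  with y , y∈B , y≤β₁ , U , h1U≡ ← certified sup p⊥≡0 β₁ _ x₀∈B x₀≤β₁ refl =
  numEq y β₁ , ((y , y∈B , y≤β₁ , refl) , minimal) , ((U , h1U≡) , λ X → h1≤numEq β₁ y y≤β₁ X y∈B)
  where
  minimal : ∀ x → InB p x → AllAtMost x β₁ → numEq y β₁ ℕ.≤ numEq x β₁
  minimal x x∈B x≤β₁ with fin≤fin y≤x ← subst (_≤∞ _) h1U≡ (h1≤numEq β₁ x x≤β₁ U x∈B) = ℤP.drop‿+≤+ y≤x
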